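{- (a) For every $p\in\beta\mathbb N$ the set $\{q\in\beta\mathbb N: p\mid_L q\}$ is closed in $\beta\mathbb N$. (b) For every $p\in\beta\mathbb N$ the sets $\{q: p\,\widetilde{\mid}\, q\}$, $\{q: q\,\widetilde{\mid}\, p\}$ and $[p]_\sim=\{q: p\,\widetilde{\mid}\,q \text{ and } q\,\widetilde{\mid}\,p\}$ are closed in $\beta\mathbb N$.
   Context: $\mathbb N=\{1,2,3,\dots\}$; $\beta\mathbb N$ is the set of ultrafilters on $\mathbb N$ (principal ultrafilters identified with elements of $\mathbb N$), with topology generated by the base sets $\overline A=\{p\in\beta\mathbb N: A\in p\}$, $A\subseteq\mathbb N$. Multiplication on $\beta\mathbb N$: $A\in p\cdot q$ iff $\{n: A/n\in q\}\in p$, where $A/n=\{a/n:a\in A,\ n\mid a\}$. $p\mid_L q$ iff $q=rp$ for some $r\in\beta\mathbb N$. For $A\subseteq \mathbb N$ let $\mid[A]=\{m\in\mathbb N:\exists a\in A\ a\mid m\}$; $p\,\widetilde{\mid}\,q$ iff $\mid[A]\in q$ for every $A\in p$. -}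

module Defs where

open import Level using (Level; _⊔_) renaming (suc to lsuc; zero to lzero)
open import Data.Nat using (ℕ; _*_; NonZero)
open import Data.Nat.Properties using (m*n≢0)
open import Data.Nat.Divisibility using (_∣_)
open import Data.Product using (Σ; Σ-syntax; _×_; _,_; proj₁; proj₂)
open import Data.Sum using (_⊎_)
open import Data.Unit using (⊤)
open import Data.Empty using (⊥)
open import Relation.Nullary using (¬_)

-- The paper's ℕ = {1,2,3,...}
ℕ⁺ : Set
ℕ⁺ = Σ ℕ NonZero

_·⁺_ : ℕ⁺ → ℕ⁺ → ℕ⁺
(m , nm) ·⁺ (n , nn) = m * n , m*n≢0 m n {{nm}} {{nn}}

_∣⁺_ : ℕ⁺ → ℕ⁺ → Set
a ∣⁺ b = proj₁ a ∣ proj₁ b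

Subset : Set₁
Subset = ℕ⁺ → Set

∅ : Subset
∅ _ = ⊥

Full : Subset
Full _ = ⊤

_ᶜ : Subset → Subset
(A ᶜ) x = ¬ A x

_∩_ : Subset → Subset → Subset
(A ∩ B) x = A x × B x

_⊆_ : Subset → Subset → Set
A ⊆ B = ∀ x → A x → B x

-- A/n = {a/n : a ∈ A, n ∣ a}, i.e. m ∈ A/n iff n·m ∈ A
_/_ : Subset → ℕ⁺ → Subset
(A / n) m = A (n ·⁺ m)

∣[_] : Subset → Subset
∣[ A ] m = Σ[ a ∈ ℕ⁺ ] (A a × (a ∣⁺ m))

-- Ultrafilters on ℕ: points of βℕ
record Ultrafilter : Set₁ where
  field
    _∋_     : Subset → Set
    full    : _∋_ Full
    proper  : ¬ (_∋_ ∅)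
    upward  : ∀ A B → A ⊆ B → _∋_ A → _∋_ B
    inter   : ∀ A B → _∋_ A → _∋_ B → _∋_ (A ∩ B)
    ultra   : ∀ A → _∋_ A ⊎ _∋_ (A ᶜ)
open Ultrafilter public

_≈U_ : Ultrafilter → Ultrafilter → Set₁
p ≈U q = ∀ A → (p ∋ A → q ∋ A) × (q ∋ A → p ∋ A)

_·∋_ : Ultrafilter → Ultrafilter → Subset → Set
(p ·∋ q) A = p ∋ (λ n → q ∋ (A / n))

_∣L_ : Ultrafilter → Ultrafilter → Set₁
p ∣L q = Σ[ r ∈ Ultrafilter ] (∀ A → (q ∋ A → (r ·∋ p) A) × ((r ·∋ p) A → q ∋ A))

_~∣_ : Ultrafilter → Ultrafilter → Set₁
p ~∣ q = ∀ A → p ∋ A → q ∋ ∣[ A ]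

-- A set S ⊆ βℕ is closed iff it contains its closure, i.e. every q all of whose
-- basic neighbourhoods Ā (A ∈ q) meet S belongs to S.
IsClosed : (Ultrafilter → Set₁) → Set₁
IsClosed S = ∀ q → (∀ A → q ∋ A → Σ[ q' ∈ Ultrafilter ] (S q' × q' ∋ A)) → S q

-- Filters on ℕ (proper) and the ultrafilter lemma (a ZFC theorem, not provable in Agda)
record Filter : Set₂ where
  field
    F∋      : Subset → Set₁
    F-full  : F∋ Full
    F-proper : ¬ (F∋ ∅)
    F-upward : ∀ A B → A ⊆ B → F∋ A → F∋ B
    F-inter  : ∀ A B → F∋ A → F∋ B → F∋ (A ∩ B)

UltrafilterLemma : Set₂
UltrafilterLemma = (F : Filter) → Σ[ U ∈ Ultrafilter ] (∀ A → Filter.F∋ F A → U ∋ A)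

module Submission where

open import Defs
open import Data.Product using (_×_; Σ-syntax; _,_; proj₁; proj₂)
open import Data.Sum using (inj₁; inj₂)
open import Data.Empty using (⊥; ⊥-elim)
open import Relation.Nullary using (¬_)

-- Closedness of {q : p ∣L q} is the only part needing the ultrafilter lemma: if every
-- neighbourhood of q meets it, then the sets Â = {n : A/n ∈ p} with A ∈ q are all
-- nonempty, so they generate a filter; any ultrafilter r extending it satisfies q = r·p.
-- The ~∣ sets are intersections of basic closed sets, hence closed outright.

∋-and-∋ᶜ⇒⊥ : (u : Ultrafilter) (A : Subset) → u ∋ A → u ∋ (A ᶜ) → ⊥
∋-and-∋ᶜ⇒⊥ u A uA uAᶜ = proper u (upward u _ ∅ (λ _ (x , ¬x) → ¬x x) (inter u A (A ᶜ) uA uAᶜ))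

∩-isClosed : {S T : Ultrafilter → Set₁} →
  IsClosed S → IsClosed T → IsClosed (λ q → S q × T q)
∩-isClosed S-closed T-closed q near =
    S-closed q (λ A qA → let (q' , (Sq' , _) , q'A) = near A qA in q' , Sq' , q'A)
  , T-closed q (λ A qA → let (q' , (_ , Tq') , q'A) = near A qA in q' , Tq' , q'A)

contains-isClosed : (P : Subset → Set) (f : Subset → Subset) →
  IsClosed (λ q → ∀ A → P A → q ∋ f A)
contains-isClosed P f q near A PA with ultra q (f A)
... | inj₁ qfA = qfA
... | inj₂ qfAᶜ =
  let (q' , q'f , q'fAᶜ) = near _ qfAᶜ in ⊥-elim (∋-and-∋ᶜ⇒⊥ q' (f A) (q'f A PA) q'fAᶜ)

membership-isClosed : (P : Subset → Set) → IsClosed (λ q → ∀ A → q ∋ A → P A)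
membership-isClosed P q near A qA = let (q' , q'P , q'A) = near A qA in q'P A q'A

~∣-right-isClosed : ∀ p → IsClosed (λ q → p ~∣ q)
~∣-right-isClosed p = contains-isClosed (p ∋_) ∣[_]

~∣-left-isClosed : ∀ p → IsClosed (λ q → q ~∣ p)
~∣-left-isClosed p = membership-isClosed (λ A → p ∋ ∣[ A ])

Monotone : (Subset → Subset) → Set₁
Monotone φ = ∀ {A B} → A ⊆ B → φ A ⊆ φ B

imageFilter : (u : Ultrafilter) (φ : Subset → Subset) → Monotone φ →
  (∀ A → u ∋ A → ¬ (φ A ⊆ ∅)) → Filter
imageFilter u φ φ-mono φ-nonempty = record
  { F∋       = λ B → Σ[ A ∈ Subset ] (u ∋ A × φ A ⊆ B)
  ; F-full   = Full , full u , λ _ _ → _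
  ; F-proper = λ (A , uA , φA⊆∅) → φ-nonempty A uA φA⊆∅
  ; F-upward = λ _ _ B⊆C (A , uA , φA⊆B) → A , uA , λ n φAn → B⊆C n (φA⊆B n φAn)
  ; F-inter  = λ _ _ (A , uA , φA⊆B) (A' , uA' , φA'⊆C) →
      A ∩ A' , inter u A A' uA uA' ,
      λ n φn → φA⊆B n (φ-mono (λ _ → proj₁) n φn) , φA'⊆C n (φ-mono (λ _ → proj₂) n φn)
  }

-- The paper's Â for A ⊆ ℕ; by definition A ∈ r·p iff Â ∈ r.
quotients : Ultrafilter → Subset → Subset
quotients p A n = p ∋ (A / n)

quotients-monotone : ∀ p → Monotone (quotients p)
quotients-monotone p A⊆B n = upward p _ _ (λ _ → A⊆B _)

·∋-and-·∋ᶜ⇒⊥ : ∀ r p A → (r ·∋ p) A → (r ·∋ p) (A ᶜ) → ⊥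
·∋-and-·∋ᶜ⇒⊥ r p A rpA rpAᶜ =
  proper r (upward r _ ∅ (λ n (pA , pAᶜ) → ∋-and-∋ᶜ⇒⊥ p (A / n) pA pAᶜ) (inter r _ _ rpA rpAᶜ))

ultrafilter-maximal : (u : Ultrafilter) (v : Subset → Set) →
  (∀ A → v A → v (A ᶜ) → ⊥) → (∀ A → u ∋ A → v A) → ∀ A → v A → u ∋ A
ultrafilter-maximal u v consistent u⊆v A vA with ultra u A
... | inj₁ uA = uA
... | inj₂ uAᶜ = ⊥-elim (consistent A vA (u⊆v (A ᶜ) uAᶜ))

∣L-isClosed : UltrafilterLemma → ∀ p → IsClosed (λ q → p ∣L q)
∣L-isClosed extend p q near =
  r , λ A → q⊆rp A , ultrafilter-maximal q (r ·∋ p) (·∋-and-·∋ᶜ⇒⊥ r p) q⊆rp A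
  where
  quotients-nonempty : ∀ A → q ∋ A → ¬ (quotients p A ⊆ ∅)
  quotients-nonempty A qA pA⊆∅ =
    let (q' , (r' , q'≈r'p) , q'A) = near A qA
    in proper r' (upward r' _ ∅ pA⊆∅ (proj₁ (q'≈r'p A) q'A))

  r : Ultrafilter
  r = proj₁ (extend (imageFilter q (quotients p) (quotients-monotone p) quotients-nonempty))

  q⊆rp : ∀ A → q ∋ A → (r ·∋ p) A
  q⊆rp A qA = proj₂ (extend _) (quotients p A) (A , qA , λ _ pAn → pAn)

mainTheorem2 : (UltrafilterLemma → ∀ p → IsClosed (λ q → p ∣L q))
    × (∀ p → IsClosed (λ q → p ~∣ q))
    × (∀ p → IsClosed (λ q → q ~∣ p))
    × (∀ p → IsClosed (λ q → (p ~∣ q) × (q ~∣ p)))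
mainTheorem2 =
    ∣L-isClosed
  , ~∣-right-isClosed
  , ~∣-left-isClosed
  , λ p → ∩-isClosed (~∣-right-isClosed p) (~∣-left-isClosed p)
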